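{- Let $(f,C)$ be a low-defect pair of degree $k$ with leading coefficient $a$. Then $\delta(f,C)\ge\delta(a)+k\ge k$. Equivalently, $\delta(f)\ge\delta(a)+k\ge k$.
   Context: $\|n\|$ is the least number of $1$'s needed to write $n\in\mathbb{N}$ using $1$, $+$, $\times$, parentheses; $\delta(n)=\|n\|-3\log_3 n$ (which is always $\ge0$). Low-defect pairs form the smallest subset of $\mathbb{Z}[x_1,x_2,\ldots]\times\mathbb{N}$ such that: (i) $(k,C)$ is one for any constant $k\in\mathbb{N}$ and $C\ge\|k\|$; (ii) if $(f_1,C_1),(f_2,C_2)$ are ones, so is $(f_1\otimes f_2,C_1+C_2)$, where $f_1\otimes f_2$ is the product after relabeling variables so they share none; (iii) if $(f,C)$ is one, $c\in\mathbb{N}$, $D\ge\|c\|$, then $(f\cdot y+c,C+D)$ is one for a new variable $y$. A degree-$k$ low-defect polynomial is multilinear in $k$ variables with nonzero leading coefficient $a$ (coefficient of the product of all variables). $\delta(f,C)=C-3\log_3 a$; $\|f\|$ is the least $C$ with $(f,C)$ a low-defect pair, and $\delta(f)=\delta(f,\|f\|)$. -}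

module Defs where

open import Data.Nat using (ℕ; zero; suc; _+_; _*_; _≤_)
open import Data.Fin using (Fin; _↑ˡ_; _↑ʳ_; fromℕ)
open import Data.Bool using (Bool; true; false; if_then_else_)
open import Data.Vec using (Vec; []; _∷_; _++_; replicate; lookup)
open import Data.List using (List; []; _∷_; map) renaming (_++_ to _++ₗ_)
open import Data.Nat.ListAction using () renaming (sum to sumₗ)
open import Data.Product using (Σ; ∃; _×_; _,_)
open import Relation.Binary.PropositionalEquality using (_≡_)

data Expr : Set where
  one  : Expr
  _⊞_  : Expr → Expr → Expr
  _⊠_  : Expr → Expr → Expr

eval : Expr → ℕ
eval one      = 1
eval (e ⊞ e') = eval e + eval e'
eval (e ⊠ e') = eval e * eval e'

ones : Expr → ℕ
ones one      = 1
ones (e ⊞ e') = ones e + ones e'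
ones (e ⊠ e') = ones e + ones e'

IsComplexity : ℕ → ℕ → Set
IsComplexity n c =
  (Σ Expr λ e → eval e ≡ n × ones e ≡ c) ×
  (∀ (e : Expr) → eval e ≡ n → c ≤ ones e)

-- Polynomials in the variables x_0,…,x_{n-1} (syntactic), with
-- natural-number constants (all low-defect polynomials live in ℕ[x]).

data Poly (n : ℕ) : Set where
  con  : ℕ → Poly n
  var  : Fin n → Poly n
  _⊕_  : Poly n → Poly n → Poly n
  _⊗ᵖ_ : Poly n → Poly n → Poly n

injˡ : ∀ {m} n → Poly m → Poly (m + n)
injˡ n (con c)   = con c
injˡ n (var i)   = var (i ↑ˡ n)
injˡ n (p ⊕ q)   = injˡ n p ⊕ injˡ n q
injˡ n (p ⊗ᵖ q)  = injˡ n p ⊗ᵖ injˡ n q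

injʳ : ∀ m {n} → Poly n → Poly (m + n)
injʳ m (con c)   = con c
injʳ m (var i)   = var (m ↑ʳ i)
injʳ m (p ⊕ q)   = injʳ m p ⊕ injʳ m q
injʳ m (p ⊗ᵖ q)  = injʳ m p ⊗ᵖ injʳ m q

_⊗_ : ∀ {m n} → Poly m → Poly n → Poly (m + n)
_⊗_ {m} {n} f g = injˡ n f ⊗ᵖ injʳ m g

extend : ∀ {n} → Poly n → ℕ → Poly (n + 1)
extend {n} f c = (injˡ 1 f ⊗ᵖ var (n ↑ʳ Fin.zero)) ⊕ con c

-- Coefficients of squarefree monomials.
-- A squarefree monomial in x_0..x_{n-1} is a subset S (Vec Bool n);
-- it denotes ∏_{i ∈ S} x_i.

Subset : ℕ → Set
Subset n = Vec Bool n

empty : ∀ {n} → Subset n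
empty {n} = replicate n false

isEmpty : ∀ {n} → Subset n → Bool
isEmpty []          = true
isEmpty (true ∷ S)  = false
isEmpty (false ∷ S) = isEmpty S

isSingleton : ∀ {n} → Fin n → Subset n → Bool
isSingleton Fin.zero    (b ∷ S) = if b then isEmpty S else false
isSingleton (Fin.suc i) (b ∷ S) = if b then false else isSingleton i S

splits : ∀ {n} → Subset n → List (Subset n × Subset n)
splits []          = ([] , []) ∷ []
splits (false ∷ S) = map (λ { (A , B) → (false ∷ A , false ∷ B) }) (splits S)
splits (true ∷ S)  =
  map (λ { (A , B) → (true ∷ A , false ∷ B) }) (splits S) ++ₗ
  map (λ { (A , B) → (false ∷ A , true ∷ B) }) (splits S)

coeff : ∀ {n} → Poly n → Subset n → ℕ
coeff (con c)  S = if isEmpty S then c else 0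
coeff (var i)  S = if isSingleton i S then 1 else 0
coeff (p ⊕ q)  S = coeff p S + coeff q S
coeff (p ⊗ᵖ q) S = sumₗ (map (λ { (A , B) → coeff p A * coeff q B }) (splits S))

full : ∀ {n} → Subset n
full {n} = replicate n true

leadingCoeff : ∀ {k} → Poly k → ℕ
leadingCoeff f = coeff f full

-- Low-defect pairs.  A pair (f , C) with f : Poly k; the index k is the
-- number of variables (= the degree of the low-defect polynomial).

data LowDefectPair : ∀ {k} → Poly k → ℕ → Set where
  ldConst  : ∀ (m C c : ℕ) → IsComplexity m c → c ≤ C →
             LowDefectPair {0} (con m) C
  ldTensor : ∀ {k₁ k₂} {f₁ : Poly k₁} {f₂ : Poly k₂} {C₁ C₂ : ℕ} →
             LowDefectPair f₁ C₁ → LowDefectPair f₂ C₂ →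
             LowDefectPair (f₁ ⊗ f₂) (C₁ + C₂)
  ldExtend : ∀ {k} {f : Poly k} {C : ℕ} (c D d : ℕ) →
             LowDefectPair f C → IsComplexity c d → d ≤ D →
             LowDefectPair (extend f c) (C + D)

-- The leading coefficient a of a low-defect pair (f , C) of degree k has a
-- representation using at most C − k ones: the leading coefficient of
-- f₁ ⊗ f₂ is the product of the leading coefficients, while f·y + c has the
-- same leading coefficient as f but costs C + ‖c‖ ≥ C + 1.  Hence
-- ‖a‖ + k ≤ C.  The remaining bound a³ ≤ 3^‖a‖ (that is, δ(a) ≥ 0) holds
-- for every expression, by induction: products are immediate, and for sums
-- one uses a + b ≤ ab when a, b ≥ 2, and (b + 1)³ ≤ 3 b³ when b ≥ 3.
module Submission where

open import Defs
open import Data.Bool using (Bool; true; false; if_then_else_; _∧_)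
open import Data.Fin using (Fin; _↑ˡ_; _↑ʳ_)
open import Data.List using (List; []; _∷_; map) renaming (_++_ to _++ₗ_)
open import Data.List.Properties using (map-++; map-∘; map-cong)
open import Data.Nat using (ℕ; zero; suc; _+_; _*_; _^_; _≤_; z≤n; s≤s)
open import Data.Nat.ListAction using () renaming (sum to sumₗ)
open import Data.Nat.ListAction.Properties using (sum-++)
open import Data.Nat.Properties
open import Algebra.Properties.CommutativeSemigroup +-commutativeSemigroup
  using (interchange)
open import Algebra.Properties.CommutativeSemiring.Exp +-*-commutativeSemiring
  using (^-distrib-*)
open import Data.Nat.Solver using (module +-*-Solver)
open import Data.Product using (Σ; _×_; _,_; proj₁; proj₂)
open import Data.Vec using ([]; _∷_; _++_)
open import Function using (_∘_)
open import Relation.Binary.PropositionalEquality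

open +-*-Solver using (solve; _:+_; _:*_; _:=_; con)

∑ : ∀ {A : Set} → (A → ℕ) → List A → ℕ
∑ g xs = sumₗ (map g xs)

module _ {A : Set} where

  ∑-++ : ∀ (g : A → ℕ) xs ys → ∑ g (xs ++ₗ ys) ≡ ∑ g xs + ∑ g ys
  ∑-++ g xs ys = trans (cong sumₗ (map-++ g xs ys)) (sum-++ (map g xs) (map g ys))

  ∑-map : ∀ {B : Set} (g : B → ℕ) (f : A → B) xs → ∑ g (map f xs) ≡ ∑ (g ∘ f) xs
  ∑-map g f xs = cong sumₗ (sym (map-∘ xs))

  ∑-cong : ∀ {g h : A → ℕ} → (∀ x → g x ≡ h x) → ∀ xs → ∑ g xs ≡ ∑ h xs
  ∑-cong g≗h xs = cong sumₗ (map-cong g≗h xs)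

  ∑-zero : ∀ (xs : List A) → ∑ (λ _ → 0) xs ≡ 0
  ∑-zero []       = refl
  ∑-zero (_ ∷ xs) = ∑-zero xs

  ∑-*ˡ : ∀ k (g : A → ℕ) xs → ∑ (λ x → k * g x) xs ≡ k * ∑ g xs
  ∑-*ˡ k g []       = sym (*-zeroʳ k)
  ∑-*ˡ k g (x ∷ xs) = trans (cong (k * g x +_) (∑-*ˡ k g xs)) (sym (*-distribˡ-+ k (g x) _))

  ∑-*ʳ : ∀ k (g : A → ℕ) xs → ∑ (λ x → g x * k) xs ≡ ∑ g xs * k
  ∑-*ʳ k g []       = refl
  ∑-*ʳ k g (x ∷ xs) = trans (cong (g x * k +_) (∑-*ʳ k g xs)) (sym (*-distribʳ-+ k (g x) _))

guard : Bool → ℕ → ℕ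
guard b x = if b then x else 0

guard-∧ : ∀ b c x → guard (b ∧ c) x ≡ guard b (guard c x)
guard-∧ true  c x = refl
guard-∧ false c x = refl

guard-comm : ∀ b c x → guard b (guard c x) ≡ guard c (guard b x)
guard-comm true  c     x = refl
guard-comm false true  x = refl
guard-comm false false x = refl

guard-+ : ∀ b x y → guard b x + guard b y ≡ guard b (x + y)
guard-+ true  x y = refl
guard-+ false x y = refl

guard-* : ∀ b c x y → guard b x * guard c y ≡ guard b (guard c (x * y))
guard-* true  true  x y = refl
guard-* true  false x y = *-zeroʳ x
guard-* false c     x y = refl

guard-*-swap : ∀ b c x y → guard b x * guard c y ≡ guard c x * guard b y
guard-*-swap b c x y = begin
  guard b x * guard c y         ≡⟨ guard-* b c x y ⟩
  guard b (guard c (x * y))     ≡⟨ guard-comm b c (x * y) ⟩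
  guard c (guard b (x * y))     ≡⟨ guard-* c b x y ⟨
  guard c x * guard b y         ∎
  where open ≡-Reasoning

∑-guard : ∀ {A : Set} b (g : A → ℕ) xs → ∑ (λ x → guard b (g x)) xs ≡ guard b (∑ g xs)
∑-guard true  g xs = refl
∑-guard false g xs = ∑-zero xs

∑-splits-emptyʳ : ∀ {n} (F : Subset n → ℕ) A →
  ∑ (λ s → guard (isEmpty (proj₂ s)) (F (proj₁ s))) (splits A) ≡ F A
∑-splits-emptyʳ F []          = +-identityʳ (F [])
∑-splits-emptyʳ F (false ∷ A) =
  trans (∑-map _ _ (splits A)) (∑-splits-emptyʳ (F ∘ (false ∷_)) A)
∑-splits-emptyʳ F (true ∷ A)  = begin
  ∑ _ (map _ (splits A) ++ₗ map _ (splits A))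
    ≡⟨ ∑-++ _ (map _ (splits A)) (map _ (splits A)) ⟩
  ∑ _ (map _ (splits A)) + ∑ _ (map _ (splits A))
    ≡⟨ cong₂ _+_ (trans (∑-map _ _ (splits A)) (∑-splits-emptyʳ (F ∘ (true ∷_)) A))
                 (trans (∑-map _ _ (splits A)) (∑-zero (splits A))) ⟩
  F (true ∷ A) + 0
    ≡⟨ +-identityʳ _ ⟩
  F (true ∷ A) ∎
  where open ≡-Reasoning

∑-splits-emptyˡ : ∀ {n} (G : Subset n → ℕ) A →
  ∑ (λ s → guard (isEmpty (proj₁ s)) (G (proj₂ s))) (splits A) ≡ G A
∑-splits-emptyˡ G []          = +-identityʳ (G [])
∑-splits-emptyˡ G (false ∷ A) =
  trans (∑-map _ _ (splits A)) (∑-splits-emptyˡ (G ∘ (false ∷_)) A)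
∑-splits-emptyˡ G (true ∷ A)  =
  trans (∑-++ _ (map _ (splits A)) (map _ (splits A)))
        (cong₂ _+_ (trans (∑-map _ _ (splits A)) (∑-zero (splits A)))
                   (trans (∑-map _ _ (splits A)) (∑-splits-emptyˡ (G ∘ (true ∷_)) A)))

∑-splits-++ : ∀ {m n} (h : Subset (m + n) × Subset (m + n) → ℕ) (A : Subset m) (B : Subset n) →
  ∑ h (splits (A ++ B)) ≡
  ∑ (λ a → ∑ (λ b → h (proj₁ a ++ proj₁ b , proj₂ a ++ proj₂ b)) (splits B)) (splits A)

∑-splits-++-cons : ∀ {m n} (h : Subset (suc m + n) × Subset (suc m + n) → ℕ) b c
  (A : Subset m) (B : Subset n) →
  ∑ h (map (λ s → b ∷ proj₁ s , c ∷ proj₂ s) (splits (A ++ B))) ≡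
  ∑ (λ a → ∑ (λ y → h (proj₁ a ++ proj₁ y , proj₂ a ++ proj₂ y)) (splits B))
    (map (λ s → b ∷ proj₁ s , c ∷ proj₂ s) (splits A))

∑-splits-++ h []          B = sym (+-identityʳ _)
∑-splits-++ h (false ∷ A) B = ∑-splits-++-cons h false false A B
∑-splits-++ h (true ∷ A)  B = begin
  ∑ h (map _ (splits (A ++ B)) ++ₗ map _ (splits (A ++ B)))
    ≡⟨ ∑-++ h (map _ (splits (A ++ B))) (map _ (splits (A ++ B))) ⟩
  ∑ h (map _ (splits (A ++ B))) + ∑ h (map _ (splits (A ++ B)))
    ≡⟨ cong₂ _+_ (∑-splits-++-cons h true false A B) (∑-splits-++-cons h false true A B) ⟩
  ∑ _ (map _ (splits A)) + ∑ _ (map _ (splits A))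
    ≡⟨ ∑-++ _ (map _ (splits A)) (map _ (splits A)) ⟨
  ∑ _ (map _ (splits A) ++ₗ map _ (splits A)) ∎
  where open ≡-Reasoning

∑-splits-++-cons h b c A B =
  trans (∑-map h _ (splits (A ++ B)))
  (trans (∑-splits-++ _ A B) (sym (∑-map _ _ (splits A))))

isEmpty-++ : ∀ {m n} (A : Subset m) (B : Subset n) → isEmpty (A ++ B) ≡ isEmpty A ∧ isEmpty B
isEmpty-++ []          B = refl
isEmpty-++ (true ∷ A)  B = refl
isEmpty-++ (false ∷ A) B = isEmpty-++ A B

isSingleton-↑ˡ-++ : ∀ {m} n (i : Fin m) (A : Subset m) (B : Subset n) →
  isSingleton (i ↑ˡ n) (A ++ B) ≡ isSingleton i A ∧ isEmpty B
isSingleton-↑ˡ-++ n Fin.zero    (true ∷ A)  B = isEmpty-++ A B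
isSingleton-↑ˡ-++ n Fin.zero    (false ∷ A) B = refl
isSingleton-↑ˡ-++ n (Fin.suc i) (true ∷ A)  B = refl
isSingleton-↑ˡ-++ n (Fin.suc i) (false ∷ A) B = isSingleton-↑ˡ-++ n i A B

isSingleton-↑ʳ-++ : ∀ m {n} (i : Fin n) (A : Subset m) (B : Subset n) →
  isSingleton (m ↑ʳ i) (A ++ B) ≡ isEmpty A ∧ isSingleton i B
isSingleton-↑ʳ-++ zero    i []          B = refl
isSingleton-↑ʳ-++ (suc m) i (true ∷ A)  B = refl
isSingleton-↑ʳ-++ (suc m) i (false ∷ A) B = isSingleton-↑ʳ-++ m i A B

coeff-injˡ : ∀ {m} n (p : Poly m) (A : Subset m) (B : Subset n) →
  coeff (injˡ n p) (A ++ B) ≡ guard (isEmpty B) (coeff p A)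
coeff-injˡ n (con c) A B = begin
  guard (isEmpty (A ++ B)) c               ≡⟨ cong (λ b → guard b c) (isEmpty-++ A B) ⟩
  guard (isEmpty A ∧ isEmpty B) c          ≡⟨ guard-∧ (isEmpty A) (isEmpty B) c ⟩
  guard (isEmpty A) (guard (isEmpty B) c)  ≡⟨ guard-comm (isEmpty A) (isEmpty B) c ⟩
  guard (isEmpty B) (guard (isEmpty A) c)  ∎
  where open ≡-Reasoning
coeff-injˡ n (var i) A B = begin
  guard (isSingleton (i ↑ˡ n) (A ++ B)) 1
    ≡⟨ cong (λ b → guard b 1) (isSingleton-↑ˡ-++ n i A B) ⟩
  guard (isSingleton i A ∧ isEmpty B) 1
    ≡⟨ guard-∧ (isSingleton i A) (isEmpty B) 1 ⟩
  guard (isSingleton i A) (guard (isEmpty B) 1)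
    ≡⟨ guard-comm (isSingleton i A) (isEmpty B) 1 ⟩
  guard (isEmpty B) (guard (isSingleton i A) 1) ∎
  where open ≡-Reasoning
coeff-injˡ n (p ⊕ q) A B =
  trans (cong₂ _+_ (coeff-injˡ n p A B) (coeff-injˡ n q A B)) (guard-+ (isEmpty B) _ _)
coeff-injˡ n (p ⊗ᵖ q) A B = begin
  coeff (injˡ n p ⊗ᵖ injˡ n q) (A ++ B)
    ≡⟨ ∑-splits-++ _ A B ⟩
  ∑ (λ a → ∑ (λ b → coeff (injˡ n p) (proj₁ a ++ proj₁ b) * coeff (injˡ n q) (proj₂ a ++ proj₂ b))
             (splits B)) (splits A)
    ≡⟨ ∑-cong inner (splits A) ⟩
  ∑ (λ a → guard (isEmpty B) (coeff p (proj₁ a) * coeff q (proj₂ a))) (splits A)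
    ≡⟨ ∑-guard (isEmpty B) _ (splits A) ⟩
  guard (isEmpty B) (coeff (p ⊗ᵖ q) A) ∎
  where
  open ≡-Reasoning
  inner : ∀ a → ∑ (λ b → coeff (injˡ n p) (proj₁ a ++ proj₁ b) * coeff (injˡ n q) (proj₂ a ++ proj₂ b))
                  (splits B)
              ≡ guard (isEmpty B) (coeff p (proj₁ a) * coeff q (proj₂ a))
  inner (a₁ , a₂) = begin
    ∑ (λ b → coeff (injˡ n p) (a₁ ++ proj₁ b) * coeff (injˡ n q) (a₂ ++ proj₂ b)) (splits B)
      ≡⟨ ∑-cong (λ b → cong₂ _*_ (coeff-injˡ n p a₁ (proj₁ b)) (coeff-injˡ n q a₂ (proj₂ b)))
                (splits B) ⟩
    ∑ (λ b → guard (isEmpty (proj₁ b)) (coeff p a₁) * guard (isEmpty (proj₂ b)) (coeff q a₂)) (splits B)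
      ≡⟨ ∑-cong (λ b → trans (guard-* (isEmpty (proj₁ b)) (isEmpty (proj₂ b)) _ _)
                             (guard-comm (isEmpty (proj₁ b)) (isEmpty (proj₂ b)) _)) (splits B) ⟩
    ∑ (λ b → guard (isEmpty (proj₂ b)) (guard (isEmpty (proj₁ b)) (coeff p a₁ * coeff q a₂))) (splits B)
      ≡⟨ ∑-splits-emptyʳ (λ b₁ → guard (isEmpty b₁) (coeff p a₁ * coeff q a₂)) B ⟩
    guard (isEmpty B) (coeff p a₁ * coeff q a₂) ∎

coeff-injʳ : ∀ m {n} (p : Poly n) (A : Subset m) (B : Subset n) →
  coeff (injʳ m p) (A ++ B) ≡ guard (isEmpty A) (coeff p B)
coeff-injʳ m (con c) A B =
  trans (cong (λ b → guard b c) (isEmpty-++ A B)) (guard-∧ (isEmpty A) (isEmpty B) c)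
coeff-injʳ m (var i) A B =
  trans (cong (λ b → guard b 1) (isSingleton-↑ʳ-++ m i A B)) (guard-∧ (isEmpty A) (isSingleton i B) 1)
coeff-injʳ m (p ⊕ q) A B =
  trans (cong₂ _+_ (coeff-injʳ m p A B) (coeff-injʳ m q A B)) (guard-+ (isEmpty A) _ _)
coeff-injʳ m (p ⊗ᵖ q) A B = begin
  coeff (injʳ m p ⊗ᵖ injʳ m q) (A ++ B)
    ≡⟨ ∑-splits-++ _ A B ⟩
  ∑ (λ a → ∑ (λ b → coeff (injʳ m p) (proj₁ a ++ proj₁ b) * coeff (injʳ m q) (proj₂ a ++ proj₂ b))
             (splits B)) (splits A)
    ≡⟨ ∑-cong inner (splits A) ⟩
  ∑ (λ a → guard (isEmpty (proj₂ a)) (guard (isEmpty (proj₁ a)) (coeff (p ⊗ᵖ q) B))) (splits A)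
    ≡⟨ ∑-splits-emptyʳ (λ a₁ → guard (isEmpty a₁) (coeff (p ⊗ᵖ q) B)) A ⟩
  guard (isEmpty A) (coeff (p ⊗ᵖ q) B) ∎
  where
  open ≡-Reasoning
  inner : ∀ a → ∑ (λ b → coeff (injʳ m p) (proj₁ a ++ proj₁ b) * coeff (injʳ m q) (proj₂ a ++ proj₂ b))
                  (splits B)
              ≡ guard (isEmpty (proj₂ a)) (guard (isEmpty (proj₁ a)) (coeff (p ⊗ᵖ q) B))
  inner (a₁ , a₂) = begin
    ∑ (λ b → coeff (injʳ m p) (a₁ ++ proj₁ b) * coeff (injʳ m q) (a₂ ++ proj₂ b)) (splits B)
      ≡⟨ ∑-cong (λ b → trans (cong₂ _*_ (coeff-injʳ m p a₁ (proj₁ b)) (coeff-injʳ m q a₂ (proj₂ b)))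
                             (guard-* (isEmpty a₁) (isEmpty a₂) _ _)) (splits B) ⟩
    ∑ (λ b → guard (isEmpty a₁) (guard (isEmpty a₂) (coeff p (proj₁ b) * coeff q (proj₂ b)))) (splits B)
      ≡⟨ ∑-guard (isEmpty a₁) _ (splits B) ⟩
    guard (isEmpty a₁) (∑ (λ b → guard (isEmpty a₂) (coeff p (proj₁ b) * coeff q (proj₂ b))) (splits B))
      ≡⟨ cong (guard (isEmpty a₁)) (∑-guard (isEmpty a₂) _ (splits B)) ⟩
    guard (isEmpty a₁) (guard (isEmpty a₂) (coeff (p ⊗ᵖ q) B))
      ≡⟨ guard-comm (isEmpty a₁) (isEmpty a₂) _ ⟩
    guard (isEmpty a₂) (guard (isEmpty a₁) (coeff (p ⊗ᵖ q) B)) ∎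

coeff-⊗ : ∀ {m n} (f : Poly m) (g : Poly n) (A : Subset m) (B : Subset n) →
  coeff (f ⊗ g) (A ++ B) ≡ coeff f A * coeff g B
coeff-⊗ {m} {n} f g A B = begin
  coeff (f ⊗ g) (A ++ B)
    ≡⟨ ∑-splits-++ _ A B ⟩
  ∑ (λ a → ∑ (λ b → coeff (injˡ n f) (proj₁ a ++ proj₁ b) * coeff (injʳ m g) (proj₂ a ++ proj₂ b))
             (splits B)) (splits A)
    ≡⟨ ∑-cong inner (splits A) ⟩
  ∑ (λ a → guard (isEmpty (proj₂ a)) (coeff f (proj₁ a)) * coeff g B) (splits A)
    ≡⟨ ∑-*ʳ (coeff g B) _ (splits A) ⟩
  ∑ (λ a → guard (isEmpty (proj₂ a)) (coeff f (proj₁ a))) (splits A) * coeff g B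
    ≡⟨ cong (_* coeff g B) (∑-splits-emptyʳ (coeff f) A) ⟩
  coeff f A * coeff g B ∎
  where
  open ≡-Reasoning
  inner : ∀ a → ∑ (λ b → coeff (injˡ n f) (proj₁ a ++ proj₁ b) * coeff (injʳ m g) (proj₂ a ++ proj₂ b))
                  (splits B)
              ≡ guard (isEmpty (proj₂ a)) (coeff f (proj₁ a)) * coeff g B
  inner (a₁ , a₂) = begin
    ∑ (λ b → coeff (injˡ n f) (a₁ ++ proj₁ b) * coeff (injʳ m g) (a₂ ++ proj₂ b)) (splits B)
      ≡⟨ ∑-cong (λ b → trans (cong₂ _*_ (coeff-injˡ n f a₁ (proj₁ b)) (coeff-injʳ m g a₂ (proj₂ b)))
                             (guard-*-swap (isEmpty (proj₁ b)) (isEmpty a₂) _ _)) (splits B) ⟩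
    ∑ (λ b → guard (isEmpty a₂) (coeff f a₁) * guard (isEmpty (proj₁ b)) (coeff g (proj₂ b))) (splits B)
      ≡⟨ ∑-*ˡ (guard (isEmpty a₂) (coeff f a₁)) _ (splits B) ⟩
    guard (isEmpty a₂) (coeff f a₁) * ∑ (λ b → guard (isEmpty (proj₁ b)) (coeff g (proj₂ b))) (splits B)
      ≡⟨ cong (guard (isEmpty a₂) (coeff f a₁) *_) (∑-splits-emptyˡ (coeff g) B) ⟩
    guard (isEmpty a₂) (coeff f a₁) * coeff g B ∎

full-++ : ∀ m n → full {m + n} ≡ full {m} ++ full {n}
full-++ zero    n = refl
full-++ (suc m) n = cong (true ∷_) (full-++ m n)

isEmpty-++-true : ∀ {n} (A : Subset n) → isEmpty (A ++ true ∷ []) ≡ false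
isEmpty-++-true []          = refl
isEmpty-++-true (true ∷ A)  = refl
isEmpty-++-true (false ∷ A) = isEmpty-++-true A

leadingCoeff-⊗ : ∀ {m n} (f : Poly m) (g : Poly n) →
  leadingCoeff (f ⊗ g) ≡ leadingCoeff f * leadingCoeff g
leadingCoeff-⊗ {m} {n} f g =
  trans (cong (coeff (f ⊗ g)) (full-++ m n)) (coeff-⊗ f g full full)

-- extend f c unfolds definitionally to (f ⊗ var {1} zero) ⊕ con c.
leadingCoeff-extend : ∀ {n} (f : Poly n) c → leadingCoeff (extend f c) ≡ leadingCoeff f
leadingCoeff-extend {n} f c = begin
  coeff (f ⊗ var {1} Fin.zero) full + guard (isEmpty (full {n + 1})) c
    ≡⟨ cong (λ S → coeff (f ⊗ var {1} Fin.zero) S + guard (isEmpty S) c) (full-++ n 1) ⟩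
  coeff (f ⊗ var {1} Fin.zero) (full {n} ++ full {1}) + guard (isEmpty (full {n} ++ full {1})) c
    ≡⟨ cong₂ _+_ (coeff-⊗ f (var {1} Fin.zero) (full {n}) (full {1}))
                 (cong (λ b → guard b c) (isEmpty-++-true (full {n}))) ⟩
  leadingCoeff f * 1 + 0
    ≡⟨ trans (+-identityʳ _) (*-identityʳ _) ⟩
  leadingCoeff f ∎
  where open ≡-Reasoning

ones-positive : ∀ e → 1 ≤ ones e
ones-positive one      = s≤s z≤n
ones-positive (e ⊞ e') = ≤-trans (ones-positive e) (m≤m+n _ _)
ones-positive (e ⊠ e') = ≤-trans (ones-positive e) (m≤m+n _ _)

leadingCoeff-expression : ∀ {k} {f : Poly k} {C} → LowDefectPair f C →
  Σ Expr λ e → eval e ≡ leadingCoeff f × ones e + k ≤ C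
leadingCoeff-expression (ldConst m C c ((e , eval≡m , ones≡c) , _) c≤C) =
  e , eval≡m , ≤-trans (≤-reflexive (trans (+-identityʳ _) ones≡c)) c≤C
leadingCoeff-expression (ldTensor {k₁} {k₂} {f₁} {f₂} p₁ p₂)
  with leadingCoeff-expression p₁ | leadingCoeff-expression p₂
... | e₁ , eval₁ , cost₁ | e₂ , eval₂ , cost₂ =
  e₁ ⊠ e₂ ,
  trans (cong₂ _*_ eval₁ eval₂) (sym (leadingCoeff-⊗ f₁ f₂)) ,
  ≤-trans (≤-reflexive (interchange (ones e₁) (ones e₂) k₁ k₂)) (+-mono-≤ cost₁ cost₂)
leadingCoeff-expression (ldExtend {k} {f} c D d p ((e_c , _ , ones≡d) , _) d≤D)
  with leadingCoeff-expression p
... | e , eval≡ , cost =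
  e ,
  trans eval≡ (sym (leadingCoeff-extend f c)) ,
  ≤-trans (≤-reflexive (sym (+-assoc (ones e) k 1)))
          (+-mono-≤ cost (≤-trans (ones-positive e_c) (≤-trans (≤-reflexive ones≡d) d≤D)))

*³≤3^+ : ∀ a b x y → a ^ 3 ≤ 3 ^ x → b ^ 3 ≤ 3 ^ y → (a * b) ^ 3 ≤ 3 ^ (x + y)
*³≤3^+ a b x y a³≤ b³≤ = begin
  (a * b) ^ 3      ≡⟨ ^-distrib-* a b 3 ⟩
  a ^ 3 * b ^ 3    ≤⟨ *-mono-≤ a³≤ b³≤ ⟩
  3 ^ x * 3 ^ y    ≡⟨ ^-distribˡ-+-* 3 x y ⟨
  3 ^ (x + y)      ∎
  where open ≤-Reasoning

+≤* : ∀ p q → (2 + p) + (2 + q) ≤ (2 + p) * (2 + q)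
+≤* p q = ≤-trans (m≤m+n _ (p + q + p * q)) (≤-reflexive (sym (identity p q)))
  where
  identity : ∀ p q → (2 + p) * (2 + q) ≡ (2 + p) + (2 + q) + (p + q + p * q)
  identity = solve 2 (λ p q → (con 2 :+ p) :* (con 2 :+ q) :=
                              (con 2 :+ p) :+ (con 2 :+ q) :+ (p :+ q :+ p :* q)) refl

-- (b + 1)³ ≤ 3 b³ holds for b ≥ 3; for b = 1, 2 the hypotheses force 3^y ≥ 3, resp. 3^y ≥ 9.
suc³≤3^suc : ∀ b {y} → 1 ≤ y → b ^ 3 ≤ 3 ^ y → suc b ^ 3 ≤ 3 ^ suc y
suc³≤3^suc 0 {y} _ _ = m^n>0 3 (suc y)
suc³≤3^suc 1 1≤y _ = ≤-trans (n≤1+n 8) (^-monoʳ-≤ 3 (s≤s 1≤y))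
suc³≤3^suc 2 {suc (suc y)} _ _ = ^-monoʳ-≤ 3 (m≤m+n 3 y)
suc³≤3^suc 2 {1} _ (s≤s (s≤s (s≤s ())))
suc³≤3^suc (suc (suc (suc t))) {y} _ b³≤ = begin
  (4 + t) ^ 3      ≤⟨ m≤m+n _ _ ⟩
  (4 + t) ^ 3 + (17 + 33 * t + 15 * (t * t) + 2 * (t * (t * t)))
                   ≡⟨ identity t ⟨
  3 * (3 + t) ^ 3  ≤⟨ *-monoʳ-≤ 3 b³≤ ⟩
  3 ^ suc y        ∎
  where
  open ≤-Reasoning
  identity : ∀ t → 3 * (3 + t) ^ 3 ≡ (4 + t) ^ 3 + (17 + 33 * t + 15 * (t * t) + 2 * (t * (t * t)))
  identity = solve 1 (λ t → con 3 :* ((con 3 :+ t) :* ((con 3 :+ t) :* ((con 3 :+ t) :* con 1))) :=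
    (con 4 :+ t) :* ((con 4 :+ t) :* ((con 4 :+ t) :* con 1)) :+
    (con 17 :+ con 33 :* t :+ con 15 :* (t :* t) :+ con 2 :* (t :* (t :* t)))) refl

+³≤3^+ : ∀ a b {x y} → 1 ≤ x → 1 ≤ y → a ^ 3 ≤ 3 ^ x → b ^ 3 ≤ 3 ^ y → (a + b) ^ 3 ≤ 3 ^ (x + y)
+³≤3^+ 0 b {x} {y} _ _ _ b³≤ = ≤-trans b³≤ (^-monoʳ-≤ 3 (m≤n+m y x))
+³≤3^+ (suc a) 0 {x} {y} _ _ a³≤ _ =
  subst (λ s → s ^ 3 ≤ 3 ^ (x + y)) (sym (+-identityʳ (suc a)))
        (≤-trans a³≤ (^-monoʳ-≤ 3 (m≤m+n x y)))
+³≤3^+ 1 b {x} {y} 1≤x 1≤y _ b³≤ =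
  ≤-trans (suc³≤3^suc b 1≤y b³≤) (^-monoʳ-≤ 3 (+-monoˡ-≤ y 1≤x))
+³≤3^+ a@(suc (suc _)) 1 {x} {y} 1≤x 1≤y a³≤ _ =
  subst₂ (λ s z → s ^ 3 ≤ 3 ^ z) (+-comm 1 a) (+-comm y x) (+³≤3^+ 1 a 1≤y 1≤x (m^n>0 3 y) a³≤)
+³≤3^+ (suc (suc p)) (suc (suc q)) {x} {y} _ _ a³≤ b³≤ =
  ≤-trans (^-monoˡ-≤ 3 (+≤* p q)) (*³≤3^+ (2 + p) (2 + q) x y a³≤ b³≤)

eval³≤3^ones : ∀ e → eval e ^ 3 ≤ 3 ^ ones e
eval³≤3^ones one      = s≤s z≤n
eval³≤3^ones (e ⊞ e') =
  +³≤3^+ (eval e) (eval e') (ones-positive e) (ones-positive e') (eval³≤3^ones e) (eval³≤3^ones e')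
eval³≤3^ones (e ⊠ e') =
  *³≤3^+ (eval e) (eval e') (ones e) (ones e') (eval³≤3^ones e) (eval³≤3^ones e')

corollary3p25 : ∀ {k : ℕ} (f : Poly k) (C : ℕ) → LowDefectPair f C →
    ∀ (c : ℕ) → IsComplexity (leadingCoeff f) c →
    (c + k ≤ C) × (leadingCoeff f ^ 3 ≤ 3 ^ c)
corollary3p25 {k} f C pair c ((e₀ , eval≡a , ones≡c) , minimal) =
  ‖a‖+k≤C , subst₂ (λ a n → a ^ 3 ≤ 3 ^ n) eval≡a ones≡c (eval³≤3^ones e₀)
  where
  ‖a‖+k≤C : c + k ≤ C
  ‖a‖+k≤C with leadingCoeff-expression pair
  ... | e , eval≡a′ , cost = ≤-trans (+-monoˡ-≤ k (minimal e eval≡a′)) cost
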